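{- A matroid $M$ is a PG-sum if and only if it is $I_3$-free, $C_4$-free, $P_5$-free and $K_4$-free.
   Context: A matroid is a pair $M=(E,G)$ where $G$ is the set of nonzero vectors of a finite-dimensional $\mathbb F_2$-vector space $V(G)=G\cup\{0\}$ and $E\subseteq G$. Isomorphism: a linear isomorphism of ambient spaces mapping ground sets onto each other. A flat of $G$ is a set $F\subseteq G$ with $F\cup\{0\}$ a subspace; $M|F=(E\cap F,F)$; $M$ is $N$-free if no $M|F$ is isomorphic to $N$. $M$ is a PG-sum if $E$ is the disjoint union of two (possibly empty) flats. All of the following are $3$-dimensional matroids (ambient space $\mathbb F_2^3$): $I_3$ has ground set a basis; $C_4$ has a four-element ground set summing to zero; $P_5$ is the (unique up to isomorphism) one with $5$ elements; $K_4$ is the (unique up to isomorphism) one with $6$ elements. -}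

module Defs where

open import Data.Nat using (ℕ)
open import Data.Bool using (Bool; true; false; _∨_; _xor_)
open import Data.Vec using (Vec; []; _∷_; replicate; zipWith)
open import Data.Product using (Σ; ∃; _×_; _,_)
open import Relation.Binary.PropositionalEquality using (_≡_; _≢_)
open import Relation.Nullary using (¬_)
open import Function.Bundles using (_⇔_)
open import Function.Definitions using (Injective)

-- Every finite-dimensional F₂-vector space is (up to linear isomorphism)
-- F₂ⁿ = Vec Bool n, with addition = pointwise xor.
V : ℕ → Set
V n = Vec Bool n

𝟎 : ∀ {n} → V n
𝟎 = replicate _ false

infixl 6 _⊕_
_⊕_ : ∀ {n} → V n → V n → V n
_⊕_ = zipWith _xor_

-- A matroid (E, G) with G = V(G) ∖ {0}, V(G) = F₂ⁿ, and E ⊆ G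
-- (E given as a decidable subset, i.e. a Bool-valued predicate).
record Matroid (n : ℕ) : Set where
  field
    E      : V n → Bool
    E-zero : E 𝟎 ≡ false
open Matroid public

-- A flat of G: a set F ⊆ G with F ∪ {0} a subspace (possibly F = ∅).
record IsFlat {n : ℕ} (F : V n → Bool) : Set where
  field
    zero∉    : F 𝟎 ≡ false
    closed   : ∀ x y → F x ≡ true → F y ≡ true → x ≢ y → F (x ⊕ y) ≡ true

Linear : ∀ {k n} → (V k → V n) → Set
Linear φ = ∀ x y → φ (x ⊕ y) ≡ φ x ⊕ φ y

-- M|F = (E ∩ F, F) is isomorphic to N = (E_N, F₂ᵏ∖{0}):
-- there is a linear isomorphism from the ambient space F ∪ {0} of M|F onto F₂ᵏ
-- mapping E ∩ F onto E_N.  We record its inverse φ : F₂ᵏ → F₂ⁿ, an injective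
-- linear map whose image of the nonzero vectors is exactly F, and which maps
-- E_N onto E ∩ F.
RestrictionIso : ∀ {n k} → Matroid n → (V n → Bool) → Matroid k → Set
RestrictionIso {n} {k} M F N =
  Σ (V k → V n) λ φ →
    Linear φ ×
    Injective _≡_ _≡_ φ ×
    (∀ v → (F v ≡ true) ⇔ (∃ λ x → x ≢ 𝟎 × φ x ≡ v)) ×
    (∀ x → E N x ≡ E M (φ x))

Free : ∀ {n k} → Matroid n → Matroid k → Set
Free {n} M N = ¬ (Σ (V n → Bool) λ F → IsFlat F × RestrictionIso M F N)

IsPGSum : ∀ {n} → Matroid n → Set
IsPGSum {n} M =
  Σ (V n → Bool) λ F₁ → Σ (V n → Bool) λ F₂ →
    IsFlat F₁ × IsFlat F₂ ×
    (∀ x → ¬ (F₁ x ≡ true × F₂ x ≡ true)) ×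
    (∀ x → E M x ≡ (F₁ x ∨ F₂ x))

eI3 : V 3 → Bool
eI3 (true  ∷ false ∷ false ∷ []) = true
eI3 (false ∷ true  ∷ false ∷ []) = true
eI3 (false ∷ false ∷ true  ∷ []) = true
eI3 _ = false

I₃ : Matroid 3
I₃ = record { E = eI3 ; E-zero = Relation.Binary.PropositionalEquality.refl }

eC4 : V 3 → Bool
eC4 (true  ∷ false ∷ false ∷ []) = true
eC4 (false ∷ true  ∷ false ∷ []) = true
eC4 (false ∷ false ∷ true  ∷ []) = true
eC4 (true  ∷ true  ∷ true  ∷ []) = true
eC4 _ = false

C₄ : Matroid 3
C₄ = record { E = eC4 ; E-zero = Relation.Binary.PropositionalEquality.refl }

eP5 : V 3 → Bool
eP5 (false ∷ false ∷ false ∷ []) = false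
eP5 (true  ∷ false ∷ false ∷ []) = false
eP5 (false ∷ true  ∷ false ∷ []) = false
eP5 _ = true

P₅ : Matroid 3
P₅ = record { E = eP5 ; E-zero = Relation.Binary.PropositionalEquality.refl }

eK4 : V 3 → Bool
eK4 (false ∷ false ∷ false ∷ []) = false
eK4 (true  ∷ true  ∷ true  ∷ []) = false
eK4 _ = true

K₄ : Matroid 3
K₄ = record { E = eK4 ; E-zero = Relation.Binary.PropositionalEquality.refl }

-- Call x, y joined when x = y or x + y ∈ E.  In a PG-sum two elements of E are
-- joined exactly when they lie in the same flat, so on E joining is transitive
-- and admits no three pairwise unjoined elements; I₃, C₄, P₅ and K₄ violate one
-- of these, and a restriction of a PG-sum is a PG-sum.  Conversely a failure of
-- transitivity spans a plane meeting E in a P₅ or a K₄, and an unjoined triple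
-- spans a plane meeting E in an I₃ or a C₄; when neither occurs, the class of any
-- element of E and its complement in E are the two flats.
module Submission where

open import Defs
open import Data.Bool using (Bool; true; false; _∨_)
import Data.Bool.Properties as Bool
open import Data.Bool.Properties
  using (xor-assoc; xor-comm; xor-identityˡ; xor-identityʳ; xor-same; ∨-zeroʳ; ¬-not)
open import Data.Empty using (⊥; ⊥-elim)
open import Data.Nat using (ℕ; zero; suc)
open import Data.Product using (Σ; ∃; _×_; _,_; proj₁; proj₂)
open import Data.Sum using (_⊎_; inj₁; inj₂; [_,_]′)
open import Data.Vec using (Vec; []; _∷_)
open import Data.Vec.Properties using (≡-dec)
open import Data.Vec.Relation.Binary.Pointwise.Inductive
  using (Pointwise-≡⇒≡; zipWith-assoc; zipWith-comm; zipWith-identityˡ; zipWith-identityʳ)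
open import Function using (_∘_; id)
open import Function.Bundles using (_⇔_; mk⇔)
open import Function.Definitions using (Injective)
open import Relation.Binary.Definitions using (DecidableEquality)
open import Relation.Binary.PropositionalEquality
open import Relation.Nullary using (¬_; Dec; yes; no; does; contradiction)
open import Relation.Nullary.Decidable
  using (map′; _×-dec_; _⊎-dec_; ¬?; dec-true; dec-false; decidable-stable; from-yes; from-no)
open import Relation.Unary using (Decidable)
open ≡-Reasoning

private variable
  n k : ℕ

⊕-assoc : (x y z : V n) → x ⊕ y ⊕ z ≡ x ⊕ (y ⊕ z)
⊕-assoc x y z = Pointwise-≡⇒≡ (zipWith-assoc xor-assoc x y z)

⊕-comm : (x y : V n) → x ⊕ y ≡ y ⊕ x
⊕-comm x y = Pointwise-≡⇒≡ (zipWith-comm xor-comm x y)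

⊕-identityˡ : (x : V n) → 𝟎 ⊕ x ≡ x
⊕-identityˡ x = Pointwise-≡⇒≡ (zipWith-identityˡ xor-identityˡ x)

⊕-identityʳ : (x : V n) → x ⊕ 𝟎 ≡ x
⊕-identityʳ x = Pointwise-≡⇒≡ (zipWith-identityʳ xor-identityʳ x)

⊕-self : (x : V n) → x ⊕ x ≡ 𝟎
⊕-self []      = refl
⊕-self (b ∷ x) = cong₂ _∷_ (xor-same b) (⊕-self x)

⊕-cancelˡ : (x y : V n) → x ⊕ (x ⊕ y) ≡ y
⊕-cancelˡ x y = begin
  x ⊕ (x ⊕ y) ≡⟨ ⊕-assoc x x y ⟨
  x ⊕ x ⊕ y   ≡⟨ cong (_⊕ y) (⊕-self x) ⟩
  𝟎 ⊕ y       ≡⟨ ⊕-identityˡ y ⟩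
  y           ∎

⊕-cancelʳ : (x y : V n) → x ⊕ y ⊕ y ≡ x
⊕-cancelʳ x y = begin
  x ⊕ y ⊕ y   ≡⟨ ⊕-assoc x y y ⟩
  x ⊕ (y ⊕ y) ≡⟨ cong (x ⊕_) (⊕-self y) ⟩
  x ⊕ 𝟎       ≡⟨ ⊕-identityʳ x ⟩
  x           ∎

⊕-interchange : (w x y z : V n) → (w ⊕ x) ⊕ (y ⊕ z) ≡ (w ⊕ y) ⊕ (x ⊕ z)
⊕-interchange w x y z = begin
  (w ⊕ x) ⊕ (y ⊕ z) ≡⟨ ⊕-assoc w x (y ⊕ z) ⟩
  w ⊕ (x ⊕ (y ⊕ z)) ≡⟨ cong (w ⊕_) (⊕-assoc x y z) ⟨
  w ⊕ (x ⊕ y ⊕ z)   ≡⟨ cong (λ s → w ⊕ (s ⊕ z)) (⊕-comm x y) ⟩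
  w ⊕ (y ⊕ x ⊕ z)   ≡⟨ cong (w ⊕_) (⊕-assoc y x z) ⟩
  w ⊕ (y ⊕ (x ⊕ z)) ≡⟨ ⊕-assoc w y (x ⊕ z) ⟨
  (w ⊕ y) ⊕ (x ⊕ z) ∎

⊕≡𝟎⇒≡ : {x y : V n} → x ⊕ y ≡ 𝟎 → x ≡ y
⊕≡𝟎⇒≡ {x = x} {y} x⊕y≡𝟎 = begin
  x         ≡⟨ ⊕-cancelʳ x y ⟨
  x ⊕ y ⊕ y ≡⟨ cong (_⊕ y) x⊕y≡𝟎 ⟩
  𝟎 ⊕ y     ≡⟨ ⊕-identityˡ y ⟩
  y         ∎

infix 4 _≟_
_≟_ : DecidableEquality (V n)
_≟_ = ≡-dec Bool._≟_

any? : {P : V k → Set} → Decidable P → Dec (∃ P)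
any? {zero}  P? = map′ ([] ,_) (λ { ([] , p) → p }) (P? [])
any? {suc k} {P} P? =
  map′ (λ { (inj₁ (x , p)) → true ∷ x , p ; (inj₂ (x , p)) → false ∷ x , p }) byHead
       (any? (P? ∘ (true ∷_)) ⊎-dec any? (P? ∘ (false ∷_)))
  where
  byHead : ∃ P → ∃ (P ∘ (true ∷_)) ⊎ ∃ (P ∘ (false ∷_))
  byHead (true  ∷ x , p) = inj₁ (x , p)
  byHead (false ∷ x , p) = inj₂ (x , p)

does≡true⇒ : {A : Set} (a? : Dec A) → does a? ≡ true → A
does≡true⇒ (yes a) _ = a

linear-𝟎 : {ψ : V k → V n} → Linear ψ → ψ 𝟎 ≡ 𝟎
linear-𝟎 {ψ = ψ} linear = begin
  ψ 𝟎         ≡⟨ cong ψ (⊕-self 𝟎) ⟨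
  ψ (𝟎 ⊕ 𝟎)   ≡⟨ linear 𝟎 𝟎 ⟩
  ψ 𝟎 ⊕ ψ 𝟎   ≡⟨ ⊕-self (ψ 𝟎) ⟩
  𝟎           ∎

kernel-trivial⇒injective : {ψ : V k → V n} → Linear ψ →
  (∀ x → ψ x ≡ 𝟎 → x ≡ 𝟎) → Injective _≡_ _≡_ ψ
kernel-trivial⇒injective {ψ = ψ} linear kernel {x} {y} ψx≡ψy = ⊕≡𝟎⇒≡ (kernel (x ⊕ y) (begin
  ψ (x ⊕ y)   ≡⟨ linear x y ⟩
  ψ x ⊕ ψ y   ≡⟨ cong (_⊕ ψ y) ψx≡ψy ⟩
  ψ y ⊕ ψ y   ≡⟨ ⊕-self (ψ y) ⟩
  𝟎           ∎))

SumClosed : (V n → Set) → Set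
SumClosed P = ∀ {x y} → P x → P y → x ≢ y → P (x ⊕ y)

isFlat-does : {P : V n → Set} (P? : Decidable P) → ¬ P 𝟎 → SumClosed P → IsFlat (does ∘ P?)
isFlat-does P? 𝟎∉P closed = record
  { zero∉  = dec-false (P? 𝟎) 𝟎∉P
  ; closed = λ x y x∈P y∈P x≢y →
      dec-true (P? (x ⊕ y)) (closed (does≡true⇒ (P? x) x∈P) (does≡true⇒ (P? y) y∈P) x≢y)
  }

flat-nonzero : {F : V n → Bool} → IsFlat F → ∀ {x} → F x ≡ true → x ≢ 𝟎
flat-nonzero flat x∈F refl = contradiction (trans (sym x∈F) (IsFlat.zero∉ flat)) λ ()

flat-cancel : {F : V n → Bool} → IsFlat F → ∀ {x y} → y ≢ 𝟎 →
  F x ≡ true → F (x ⊕ y) ≡ true → F y ≡ true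
flat-cancel {F = F} flat {x} {y} y≢𝟎 x∈F x⊕y∈F =
  subst (λ v → F v ≡ true) (⊕-cancelˡ x y) (IsFlat.closed flat x (x ⊕ y) x∈F x⊕y∈F x≢x⊕y)
  where
  x≢x⊕y : x ≢ x ⊕ y
  x≢x⊕y x≡x⊕y = y≢𝟎 (begin
    y           ≡⟨ ⊕-cancelˡ x y ⟨
    x ⊕ (x ⊕ y) ≡⟨ cong (x ⊕_) x≡x⊕y ⟨
    x ⊕ x       ≡⟨ ⊕-self x ⟩
    𝟎           ∎)

flat-preimage : {ψ : V k → V n} {F : V n → Bool} → Linear ψ → Injective _≡_ _≡_ ψ →
  IsFlat F → IsFlat (F ∘ ψ)
flat-preimage {ψ = ψ} {F} linear injective flat = record
  { zero∉  = trans (cong F (linear-𝟎 linear)) (IsFlat.zero∉ flat)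
  ; closed = λ x y x∈ y∈ x≢y →
      trans (cong F (linear x y)) (IsFlat.closed flat (ψ x) (ψ y) x∈ y∈ (x≢y ∘ injective))
  }

HasRestriction : Matroid n → Matroid k → Set
HasRestriction {n} M N = Σ (V n → Bool) λ F → IsFlat F × RestrictionIso M F N

embedding⇒restriction : {M : Matroid n} {N : Matroid k} {ψ : V k → V n} →
  Linear ψ → Injective _≡_ _≡_ ψ → (∀ x → E N x ≡ E M (ψ x)) → HasRestriction M N
embedding⇒restriction {n = n} {ψ = ψ} linear injective E-pattern =
  does ∘ Image? , isFlat-does Image? 𝟎∉Image image-closed ,
  ψ , linear , injective , (λ v → mk⇔ (does≡true⇒ (Image? v)) (dec-true (Image? v))) , E-pattern
  where
  Image : V n → Set
  Image v = ∃ λ x → x ≢ 𝟎 × ψ x ≡ v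

  Image? : Decidable Image
  Image? v = any? λ x → ¬? (x ≟ 𝟎) ×-dec ψ x ≟ v

  𝟎∉Image : ¬ Image 𝟎
  𝟎∉Image (x , x≢𝟎 , ψx≡𝟎) = x≢𝟎 (injective (trans ψx≡𝟎 (sym (linear-𝟎 linear))))

  image-closed : SumClosed Image
  image-closed (x , _ , refl) (y , _ , refl) ψx≢ψy =
    x ⊕ y , (λ x⊕y≡𝟎 → ψx≢ψy (cong ψ (⊕≡𝟎⇒≡ x⊕y≡𝟎))) , linear x y

combination : Vec (V n) k → V k → V n
combination []       []          = 𝟎
combination (v ∷ vs) (true  ∷ x) = v ⊕ combination vs x
combination (v ∷ vs) (false ∷ x) = combination vs x

combination-linear : (vs : Vec (V n) k) → Linear (combination vs)
combination-linear [] [] [] = sym (⊕-self 𝟎)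
combination-linear (v ∷ vs) (false ∷ x) (false ∷ y) = combination-linear vs x y
combination-linear (v ∷ vs) (true ∷ x) (false ∷ y) = begin
  v ⊕ combination vs (x ⊕ y)                     ≡⟨ cong (v ⊕_) (combination-linear vs x y) ⟩
  v ⊕ (combination vs x ⊕ combination vs y)      ≡⟨ ⊕-assoc v _ _ ⟨
  v ⊕ combination vs x ⊕ combination vs y        ∎
combination-linear (v ∷ vs) (false ∷ x) (true ∷ y) = begin
  v ⊕ combination vs (x ⊕ y)                     ≡⟨ cong (v ⊕_) (combination-linear vs x y) ⟩
  v ⊕ (combination vs x ⊕ combination vs y)      ≡⟨ ⊕-assoc v _ _ ⟨
  v ⊕ combination vs x ⊕ combination vs y        ≡⟨ cong (_⊕ combination vs y) (⊕-comm v _) ⟩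
  combination vs x ⊕ v ⊕ combination vs y        ≡⟨ ⊕-assoc _ v _ ⟩
  combination vs x ⊕ (v ⊕ combination vs y)      ∎
combination-linear (v ∷ vs) (true ∷ x) (true ∷ y) = begin
  combination vs (x ⊕ y)                         ≡⟨ combination-linear vs x y ⟩
  combination vs x ⊕ combination vs y            ≡⟨ ⊕-identityˡ _ ⟨
  𝟎 ⊕ (combination vs x ⊕ combination vs y)      ≡⟨ cong (_⊕ _) (⊕-self v) ⟨
  v ⊕ v ⊕ (combination vs x ⊕ combination vs y)  ≡⟨ ⊕-interchange v v _ _ ⟩
  (v ⊕ combination vs x) ⊕ (v ⊕ combination vs y) ∎

pattern e₁   = true  ∷ false ∷ false ∷ []
pattern e₂   = false ∷ true  ∷ false ∷ []
pattern e₃   = false ∷ false ∷ true  ∷ []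
pattern e₁₂  = true  ∷ true  ∷ false ∷ []
pattern e₁₃  = true  ∷ false ∷ true  ∷ []
pattern e₂₃  = false ∷ true  ∷ true  ∷ []
pattern e₁₂₃ = true  ∷ true  ∷ true  ∷ []

module _ (p q r : V n) where

  span₃-elim : (Q : V 3 → V n → Set) →
    Q 𝟎 𝟎 → Q e₁ p → Q e₂ q → Q e₃ r →
    Q e₁₂ (p ⊕ q) → Q e₁₃ (p ⊕ r) → Q e₂₃ (q ⊕ r) → Q e₁₂₃ (p ⊕ q ⊕ r) →
    ∀ x → Q x (combination (p ∷ q ∷ r ∷ []) x)
  span₃-elim Q Q₀ _ _ _ _ _ _ _ (false ∷ false ∷ false ∷ []) = Q₀
  span₃-elim Q _ Q₁ _ _ _ _ _ _ e₁   = subst (Q e₁) (sym (⊕-identityʳ p)) Q₁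
  span₃-elim Q _ _ Q₂ _ _ _ _ _ e₂   = subst (Q e₂) (sym (⊕-identityʳ q)) Q₂
  span₃-elim Q _ _ _ Q₃ _ _ _ _ e₃   = subst (Q e₃) (sym (⊕-identityʳ r)) Q₃
  span₃-elim Q _ _ _ _ Q₁₂ _ _ _ e₁₂ = subst (Q e₁₂) (cong (p ⊕_) (sym (⊕-identityʳ q))) Q₁₂
  span₃-elim Q _ _ _ _ _ Q₁₃ _ _ e₁₃ = subst (Q e₁₃) (cong (p ⊕_) (sym (⊕-identityʳ r))) Q₁₃
  span₃-elim Q _ _ _ _ _ _ Q₂₃ _ e₂₃ = subst (Q e₂₃) (cong (q ⊕_) (sym (⊕-identityʳ r))) Q₂₃
  span₃-elim Q _ _ _ _ _ _ _ Q₁₂₃ e₁₂₃ =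
    subst (Q e₁₂₃) (trans (⊕-assoc p q r) (cong (λ s → p ⊕ (q ⊕ s)) (sym (⊕-identityʳ r)))) Q₁₂₃

  Independent₃ : Set
  Independent₃ = ∀ x → combination (p ∷ q ∷ r ∷ []) x ≡ 𝟎 → x ≡ 𝟎

  independent₃ : p ≢ 𝟎 → q ≢ 𝟎 → r ≢ 𝟎 → p ⊕ q ≢ 𝟎 → p ⊕ r ≢ 𝟎 → q ⊕ r ≢ 𝟎 → p ⊕ q ⊕ r ≢ 𝟎 →
    Independent₃
  independent₃ p≢𝟎 q≢𝟎 r≢𝟎 pq≢𝟎 pr≢𝟎 qr≢𝟎 pqr≢𝟎 =
    span₃-elim (λ x v → v ≡ 𝟎 → x ≡ 𝟎) (λ _ → refl)
      (⊥-elim ∘ p≢𝟎) (⊥-elim ∘ q≢𝟎) (⊥-elim ∘ r≢𝟎)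
      (⊥-elim ∘ pq≢𝟎) (⊥-elim ∘ pr≢𝟎) (⊥-elim ∘ qr≢𝟎) (⊥-elim ∘ pqr≢𝟎)

  plane-restriction : (M : Matroid n) (N : Matroid 3) → Independent₃ →
    E M p ≡ E N e₁ → E M q ≡ E N e₂ → E M r ≡ E N e₃ →
    E M (p ⊕ q) ≡ E N e₁₂ → E M (p ⊕ r) ≡ E N e₁₃ → E M (q ⊕ r) ≡ E N e₂₃ →
    E M (p ⊕ q ⊕ r) ≡ E N e₁₂₃ → HasRestriction M N
  plane-restriction M N independent Ep Eq Er Epq Epr Eqr Epqr =
    embedding⇒restriction {M = M} {N = N} linear (kernel-trivial⇒injective linear independent)
      (span₃-elim (λ x v → E N x ≡ E M v) (trans (E-zero N) (sym (E-zero M)))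
        (sym Ep) (sym Eq) (sym Er) (sym Epq) (sym Epr) (sym Eqr) (sym Epqr))
    where
    linear = combination-linear (p ∷ q ∷ r ∷ [])

Joined : Matroid n → V n → V n → Set
Joined M x y = x ≡ y ⊎ E M (x ⊕ y) ≡ true

joined? : (M : Matroid n) → ∀ x y → Dec (Joined M x y)
joined? M x y = x ≟ y ⊎-dec E M (x ⊕ y) Bool.≟ true

JoinedTransitive : Matroid n → Set
JoinedTransitive M = ∀ {x y z} → E M x ≡ true → E M y ≡ true → E M z ≡ true →
  Joined M x y → Joined M y z → Joined M x z

NoUnjoinedTriple : Matroid n → Set
NoUnjoinedTriple M = ∀ {x y z} → E M x ≡ true → E M y ≡ true → E M z ≡ true →
  ¬ Joined M x y → ¬ Joined M y z → ¬ Joined M x z → ⊥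

-- PG-sums: joined means lying in the same flat

module PGSumSides (M : Matroid n) {F₁ F₂ : V n → Bool} (flat₁ : IsFlat F₁) (flat₂ : IsFlat F₂)
  (disjoint : ∀ x → ¬ (F₁ x ≡ true × F₂ x ≡ true)) (cover : ∀ x → E M x ≡ (F₁ x ∨ F₂ x)) where

  ∈₁⇒∈E : ∀ {x} → F₁ x ≡ true → E M x ≡ true
  ∈₁⇒∈E {x} x∈₁ = trans (cover x) (cong (_∨ F₂ x) x∈₁)

  ∈₂⇒∈E : ∀ {x} → F₂ x ≡ true → E M x ≡ true
  ∈₂⇒∈E {x} x∈₂ = trans (cover x) (trans (cong (F₁ x ∨_) x∈₂) (∨-zeroʳ (F₁ x)))

  ∉₁⇒∈₂ : ∀ {x} → E M x ≡ true → F₁ x ≡ false → F₂ x ≡ true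
  ∉₁⇒∈₂ {x} x∈E x∉₁ = trans (sym (cong (_∨ F₂ x) x∉₁)) (trans (sym (cover x)) x∈E)

  cross-∉E : ∀ {x y} → F₁ x ≡ true → F₂ y ≡ true → E M (x ⊕ y) ≢ true
  cross-∉E {x} {y} x∈₁ y∈₂ x⊕y∈E with F₁ (x ⊕ y) in x⊕y∈₁?
  ... | true  = disjoint y (flat-cancel flat₁ (flat-nonzero flat₂ y∈₂) x∈₁ x⊕y∈₁? , y∈₂)
  ... | false = disjoint x (x∈₁ , flat-cancel flat₂ (flat-nonzero flat₁ x∈₁) y∈₂
                  (trans (cong F₂ (⊕-comm y x)) (∉₁⇒∈₂ x⊕y∈E x⊕y∈₁?)))

  joined⇒same-side : ∀ {x y} → E M x ≡ true → E M y ≡ true → Joined M x y → F₁ x ≡ F₁ y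
  joined⇒same-side _ _ (inj₁ refl) = refl
  joined⇒same-side {x} {y} x∈E y∈E (inj₂ x⊕y∈E) with F₁ x in x∈₁? | F₁ y in y∈₁?
  ... | true  | true  = refl
  ... | false | false = refl
  ... | true  | false = ⊥-elim (cross-∉E x∈₁? (∉₁⇒∈₂ y∈E y∈₁?) x⊕y∈E)
  ... | false | true  =
    ⊥-elim (cross-∉E y∈₁? (∉₁⇒∈₂ x∈E x∈₁?) (trans (cong (E M) (⊕-comm y x)) x⊕y∈E))

  same-side⇒joined : ∀ {x y} → E M x ≡ true → E M y ≡ true → F₁ x ≡ F₁ y → Joined M x y
  same-side⇒joined {x} {y} x∈E y∈E same with x ≟ y | F₁ x in x∈₁?
  ... | yes x≡y | _     = inj₁ x≡y
  ... | no  x≢y | true  = inj₂ (∈₁⇒∈E (IsFlat.closed flat₁ x y x∈₁? (sym same) x≢y))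
  ... | no  x≢y | false = inj₂ (∈₂⇒∈E (IsFlat.closed flat₂ x y
                            (∉₁⇒∈₂ x∈E x∈₁?) (∉₁⇒∈₂ y∈E (sym same)) x≢y))

bool-pigeonhole : ∀ (a b c : Bool) → a ≡ b ⊎ b ≡ c ⊎ a ≡ c
bool-pigeonhole false false _     = inj₁ refl
bool-pigeonhole true  true  _     = inj₁ refl
bool-pigeonhole false true  true  = inj₂ (inj₁ refl)
bool-pigeonhole true  false false = inj₂ (inj₁ refl)
bool-pigeonhole false true  false = inj₂ (inj₂ refl)
bool-pigeonhole true  false true  = inj₂ (inj₂ refl)

PGSum⇒joined-trans : (M : Matroid n) → IsPGSum M → JoinedTransitive M
PGSum⇒joined-trans M (_ , _ , flat₁ , flat₂ , disjoint , cover) x∈E y∈E z∈E x~y y~z =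
  same-side⇒joined x∈E z∈E (trans (joined⇒same-side x∈E y∈E x~y) (joined⇒same-side y∈E z∈E y~z))
  where open PGSumSides M flat₁ flat₂ disjoint cover

PGSum⇒no-unjoined-triple : (M : Matroid n) → IsPGSum M → NoUnjoinedTriple M
PGSum⇒no-unjoined-triple M (F₁ , _ , flat₁ , flat₂ , disjoint , cover) {x} {y} {z}
  x∈E y∈E z∈E x≁y y≁z x≁z =
  [ x≁y ∘ same-side⇒joined x∈E y∈E
  , [ y≁z ∘ same-side⇒joined y∈E z∈E , x≁z ∘ same-side⇒joined x∈E z∈E ]′
  ]′ (bool-pigeonhole (F₁ x) (F₁ y) (F₁ z))
  where open PGSumSides M flat₁ flat₂ disjoint cover

PGSum-restriction : {M : Matroid n} {N : Matroid k} {F : V n → Bool} →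
  IsPGSum M → RestrictionIso M F N → IsPGSum N
PGSum-restriction (F₁ , F₂ , flat₁ , flat₂ , disjoint , cover)
                  (ψ , linear , injective , _ , E-pattern) =
  F₁ ∘ ψ , F₂ ∘ ψ , flat-preimage linear injective flat₁ , flat-preimage linear injective flat₂ ,
  disjoint ∘ ψ , λ x → trans (E-pattern x) (cover (ψ x))

PGSum⇒Free : (M : Matroid n) (N : Matroid k) → IsPGSum M → ¬ IsPGSum N → Free M N
PGSum⇒Free M N pgM ¬pgN (F , _ , iso) = ¬pgN (PGSum-restriction {M = M} {N} {F} pgM iso)

¬PGSum-I₃ : ¬ IsPGSum I₃
¬PGSum-I₃ pg = PGSum⇒no-unjoined-triple I₃ pg {e₁} {e₂} {e₃} refl refl refl
  (from-no (joined? I₃ e₁ e₂)) (from-no (joined? I₃ e₂ e₃)) (from-no (joined? I₃ e₁ e₃))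

¬PGSum-C₄ : ¬ IsPGSum C₄
¬PGSum-C₄ pg = PGSum⇒no-unjoined-triple C₄ pg {e₁} {e₂} {e₃} refl refl refl
  (from-no (joined? C₄ e₁ e₂)) (from-no (joined? C₄ e₂ e₃)) (from-no (joined? C₄ e₁ e₃))

¬PGSum-P₅ : ¬ IsPGSum P₅
¬PGSum-P₅ pg = from-no (joined? P₅ e₃ e₁₃)
  (PGSum⇒joined-trans P₅ pg {e₃} {e₁₂} {e₁₃} refl refl refl
    (from-yes (joined? P₅ e₃ e₁₂)) (from-yes (joined? P₅ e₁₂ e₁₃)))

¬PGSum-K₄ : ¬ IsPGSum K₄
¬PGSum-K₄ pg = from-no (joined? K₄ e₁₂ e₃)
  (PGSum⇒joined-trans K₄ pg {e₁₂} {e₁} {e₃} refl refl refl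
    (from-yes (joined? K₄ e₁₂ e₁)) (from-yes (joined? K₄ e₁ e₃)))

module _ (M : Matroid n) where

  E-resp : ∀ {x y b} → x ≡ y → E M y ≡ b → E M x ≡ b
  E-resp x≡y Ey = trans (cong (E M) x≡y) Ey

  E-distinct : ∀ {x y} → E M x ≡ false → E M y ≡ true → x ≢ y
  E-distinct x∉E y∈E refl = contradiction (trans (sym x∉E) y∈E) λ ()

  ∈E⇒≢𝟎 : ∀ {x} → E M x ≡ true → x ≢ 𝟎
  ∈E⇒≢𝟎 x∈E x≡𝟎 = E-distinct (E-zero M) x∈E (sym x≡𝟎)

  joined-sym : ∀ {x y} → Joined M x y → Joined M y x
  joined-sym (inj₁ x≡y)         = inj₁ (sym x≡y)
  joined-sym {x} {y} (inj₂ x⊕y∈E) = inj₂ (E-resp (⊕-comm y x) x⊕y∈E)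

  joined-⊕ : ∀ {x y} → E M y ≡ true → Joined M x (x ⊕ y)
  joined-⊕ {x} {y} y∈E = inj₂ (E-resp (⊕-cancelˡ x y) y∈E)

  joined-≢⇒∈E : ∀ {x y} → Joined M x y → x ≢ y → E M (x ⊕ y) ≡ true
  joined-≢⇒∈E (inj₁ x≡y)   x≢y = contradiction x≡y x≢y
  joined-≢⇒∈E (inj₂ x⊕y∈E) _   = x⊕y∈E

  unjoined⇒∉E : ∀ {x y} → ¬ Joined M x y → E M (x ⊕ y) ≡ false
  unjoined⇒∉E x≁y = ¬-not (x≁y ∘ inj₂)

  unjoined⇒⊕≢𝟎 : ∀ {x y} → ¬ Joined M x y → x ⊕ y ≢ 𝟎
  unjoined⇒⊕≢𝟎 x≁y = x≁y ∘ inj₁ ∘ ⊕≡𝟎⇒≡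

  unjoined-independent : ∀ {x y z} → E M x ≡ true → E M y ≡ true → E M z ≡ true →
    ¬ Joined M x y → ¬ Joined M y z → ¬ Joined M x z → Independent₃ x y z
  unjoined-independent {x} {y} {z} x∈E y∈E z∈E x≁y y≁z x≁z =
    independent₃ x y z (∈E⇒≢𝟎 x∈E) (∈E⇒≢𝟎 y∈E) (∈E⇒≢𝟎 z∈E)
      (unjoined⇒⊕≢𝟎 x≁y) (unjoined⇒⊕≢𝟎 x≁z) (unjoined⇒⊕≢𝟎 y≁z)
      (E-distinct (unjoined⇒∉E x≁y) z∈E ∘ ⊕≡𝟎⇒≡)

  free⇒no-unjoined-triple : Free M I₃ → Free M C₄ → NoUnjoinedTriple M
  free⇒no-unjoined-triple I₃-free C₄-free {x} {y} {z} x∈E y∈E z∈E x≁y y≁z x≁z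
    with E M (x ⊕ y ⊕ z) in x⊕y⊕z∈E?
  ... | false = I₃-free (plane-restriction x y z M I₃ independent x∈E y∈E z∈E
                  (unjoined⇒∉E x≁y) (unjoined⇒∉E x≁z) (unjoined⇒∉E y≁z) x⊕y⊕z∈E?)
    where independent = unjoined-independent x∈E y∈E z∈E x≁y y≁z x≁z
  ... | true  = C₄-free (plane-restriction x y z M C₄ independent x∈E y∈E z∈E
                  (unjoined⇒∉E x≁y) (unjoined⇒∉E x≁z) (unjoined⇒∉E y≁z) x⊕y⊕z∈E?)
    where independent = unjoined-independent x∈E y∈E z∈E x≁y y≁z x≁z

  K₄-restriction : ∀ {x y z} → E M x ≡ true → E M y ≡ true → E M z ≡ true →
    E M (x ⊕ y) ≡ true → E M (y ⊕ z) ≡ true → ¬ Joined M x z → E M (x ⊕ y ⊕ z) ≡ true →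
    HasRestriction M K₄
  K₄-restriction {x} {y} {z} x∈E y∈E z∈E x⊕y∈E y⊕z∈E x≁z x⊕y⊕z∈E =
    plane-restriction (x ⊕ y) y z M K₄ independent x⊕y∈E y∈E z∈E x⊕y⊕y∈E x⊕y⊕z∈E y⊕z∈E
      (E-resp (cong (_⊕ z) (⊕-cancelʳ x y)) (unjoined⇒∉E x≁z))
    where
    x⊕y⊕y∈E : E M (x ⊕ y ⊕ y) ≡ true
    x⊕y⊕y∈E = E-resp (⊕-cancelʳ x y) x∈E

    independent : Independent₃ (x ⊕ y) y z
    independent = independent₃ (x ⊕ y) y z (∈E⇒≢𝟎 x⊕y∈E) (∈E⇒≢𝟎 y∈E) (∈E⇒≢𝟎 z∈E)
      (∈E⇒≢𝟎 x⊕y⊕y∈E) (∈E⇒≢𝟎 x⊕y⊕z∈E) (∈E⇒≢𝟎 y⊕z∈E)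
      (unjoined⇒⊕≢𝟎 x≁z ∘ trans (cong (_⊕ z) (sym (⊕-cancelʳ x y))))

  P₅-restriction : ∀ {x y z} → E M x ≡ true → E M y ≡ true → E M z ≡ true →
    E M (x ⊕ y) ≡ true → E M (y ⊕ z) ≡ true → ¬ Joined M x z → E M (x ⊕ y ⊕ z) ≡ false →
    HasRestriction M P₅
  P₅-restriction {x} {y} {z} x∈E y∈E z∈E x⊕y∈E y⊕z∈E x≁z x⊕y⊕z∉E =
    plane-restriction p q z M P₅ independent p∉E x⊕y⊕z∉E z∈E p⊕q∈E p⊕z∈E q⊕z∈E p⊕q⊕z∈E
    where
    p = x ⊕ z
    q = x ⊕ y ⊕ z

    p⊕q≡y : p ⊕ q ≡ y
    p⊕q≡y = begin
      (x ⊕ z) ⊕ (x ⊕ y ⊕ z)   ≡⟨ ⊕-interchange x z (x ⊕ y) z ⟩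
      (x ⊕ (x ⊕ y)) ⊕ (z ⊕ z) ≡⟨ cong₂ _⊕_ (⊕-cancelˡ x y) (⊕-self z) ⟩
      y ⊕ 𝟎                   ≡⟨ ⊕-identityʳ y ⟩
      y                       ∎

    p∉E : E M p ≡ false
    p∉E = unjoined⇒∉E x≁z

    p⊕q∈E : E M (p ⊕ q) ≡ true
    p⊕q∈E = E-resp p⊕q≡y y∈E

    p⊕z∈E : E M (p ⊕ z) ≡ true
    p⊕z∈E = E-resp (⊕-cancelʳ x z) x∈E

    q⊕z∈E : E M (q ⊕ z) ≡ true
    q⊕z∈E = E-resp (⊕-cancelʳ (x ⊕ y) z) x⊕y∈E

    p⊕q⊕z∈E : E M (p ⊕ q ⊕ z) ≡ true
    p⊕q⊕z∈E = E-resp (cong (_⊕ z) p⊕q≡y) y⊕z∈E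

    -- q = 𝟎 would force p = x ⊕ (x ⊕ y) = y ∈ E
    q≢𝟎 : q ≢ 𝟎
    q≢𝟎 q≡𝟎 = E-distinct p∉E y∈E (trans (cong (x ⊕_) (sym (⊕≡𝟎⇒≡ q≡𝟎))) (⊕-cancelˡ x y))

    independent : Independent₃ p q z
    independent = independent₃ p q z (unjoined⇒⊕≢𝟎 x≁z) q≢𝟎 (∈E⇒≢𝟎 z∈E)
      (∈E⇒≢𝟎 p⊕q∈E) (∈E⇒≢𝟎 p⊕z∈E) (∈E⇒≢𝟎 q⊕z∈E) (∈E⇒≢𝟎 p⊕q⊕z∈E)

  free⇒joined-trans : Free M K₄ → Free M P₅ → JoinedTransitive M
  free⇒joined-trans _ _ _ _ _ (inj₁ refl) y~z = y~z
  free⇒joined-trans _ _ _ _ _ (inj₂ x⊕y∈E) (inj₁ refl) = inj₂ x⊕y∈E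
  free⇒joined-trans K₄-free P₅-free {x} {y} {z} x∈E y∈E z∈E (inj₂ x⊕y∈E) (inj₂ y⊕z∈E)
    with joined? M x z | E M (x ⊕ y ⊕ z) in x⊕y⊕z∈E?
  ... | yes x~z | _     = x~z
  ... | no  x≁z | true  = ⊥-elim (K₄-free (K₄-restriction x∈E y∈E z∈E x⊕y∈E y⊕z∈E x≁z x⊕y⊕z∈E?))
  ... | no  x≁z | false = ⊥-elim (P₅-free (P₅-restriction x∈E y∈E z∈E x⊕y∈E y⊕z∈E x≁z x⊕y⊕z∈E?))

  PGSum-split : {P : V n → Set} → Decidable P →
    SumClosed (λ x → E M x ≡ true × P x) → SumClosed (λ x → E M x ≡ true × ¬ P x) → IsPGSum M
  PGSum-split {P} P? closed₁ closed₂ =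
    does ∘ Side₁? , does ∘ Side₂? ,
    isFlat-does Side₁? (𝟎∉E ∘ proj₁) closed₁ , isFlat-does Side₂? (𝟎∉E ∘ proj₁) closed₂ ,
    disjoint , λ x → split-cover (E M x) (P? x)
    where
    Side₁? : Decidable (λ x → E M x ≡ true × P x)
    Side₁? x = E M x Bool.≟ true ×-dec P? x

    Side₂? : Decidable (λ x → E M x ≡ true × ¬ P x)
    Side₂? x = E M x Bool.≟ true ×-dec ¬? (P? x)

    𝟎∉E : E M 𝟎 ≢ true
    𝟎∉E 𝟎∈E = ∈E⇒≢𝟎 𝟎∈E refl

    disjoint : ∀ x → ¬ (does (Side₁? x) ≡ true × does (Side₂? x) ≡ true)
    disjoint x (x∈₁ , x∈₂) = proj₂ (does≡true⇒ (Side₂? x) x∈₂) (proj₂ (does≡true⇒ (Side₁? x) x∈₁))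

    split-cover : ∀ {A : Set} b (a? : Dec A) →
      b ≡ (does ((b Bool.≟ true) ×-dec a?) ∨ does ((b Bool.≟ true) ×-dec ¬? a?))
    split-cover false _       = refl
    split-cover true  (yes _) = refl
    split-cover true  (no _)  = refl

  joined⇒PGSum : JoinedTransitive M → NoUnjoinedTriple M → IsPGSum M
  joined⇒PGSum joined-trans no-triple with any? (λ a → E M a Bool.≟ true)
  ... | no  E-empty = PGSum-split {P = λ _ → ⊥} (λ _ → no id) (λ { (_ , ()) })
                        (λ (x∈E , _) _ _ → ⊥-elim (E-empty (_ , x∈E)))
  ... | yes (a , a∈E) = PGSum-split (λ x → joined? M x a) class-closed complement-closed
    where
    class-closed : SumClosed (λ x → E M x ≡ true × Joined M x a)
    class-closed {x} {y} (x∈E , x~a) (y∈E , y~a) x≢y =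
      x⊕y∈E , joined-trans x⊕y∈E x∈E a∈E (joined-sym (joined-⊕ y∈E)) x~a
      where
      x⊕y∈E = joined-≢⇒∈E (joined-trans x∈E a∈E y∈E x~a (joined-sym y~a)) x≢y

    complement-closed : SumClosed (λ x → E M x ≡ true × ¬ Joined M x a)
    complement-closed {x} {y} (x∈E , x≁a) (y∈E , y≁a) x≢y =
      x⊕y∈E , λ x⊕y~a → x≁a (joined-trans x∈E x⊕y∈E a∈E (joined-⊕ y∈E) x⊕y~a)
      where
      x⊕y∈E : E M (x ⊕ y) ≡ true
      x⊕y∈E = decidable-stable (E M (x ⊕ y) Bool.≟ true) λ x⊕y∉E →
        no-triple x∈E y∈E a∈E (λ x~y → x⊕y∉E (joined-≢⇒∈E x~y x≢y)) y≁a x≁a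

lemma2p10 : ∀ (n : ℕ) (M : Matroid n) →
    IsPGSum M ⇔ (Free M I₃ × Free M C₄ × Free M P₅ × Free M K₄)
lemma2p10 n M = mk⇔
  (λ pg → PGSum⇒Free M I₃ pg ¬PGSum-I₃ , PGSum⇒Free M C₄ pg ¬PGSum-C₄ ,
          PGSum⇒Free M P₅ pg ¬PGSum-P₅ , PGSum⇒Free M K₄ pg ¬PGSum-K₄)
  (λ (I₃-free , C₄-free , P₅-free , K₄-free) →
     joined⇒PGSum M (free⇒joined-trans M K₄-free P₅-free)
                    (free⇒no-unjoined-triple M I₃-free C₄-free))
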